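{- Let $I=(A,\succ)$ be a Stable Roommates instance and let $J=(A,\succ,c)$ be the SF instance with $c_i=1$ for all $a_i\in A$. Then a permutation $\Pi$ of $A$ is a stable partition of $I$ if and only if the collection of cyclic permutations in the cycle decomposition of $\Pi$ (fixed points included) is a GSP of $J$.
   Context: A Stable Roommates instance $I=(A,\succ)$ consists of a finite set $A=\{a_1,\dots,a_n\}$ of agents, each $a_i$ having a strict linear order $\succ_i$ over $A\setminus\{a_i\}$, with the convention that every agent ranks itself last; $a\succeq_i b$ means $a\succ_i b$ or $a=b$. A stable partition of $I$ is a permutation $\Pi$ of $A$ such that (T1) for all $a_i$, $\Pi(a_i)\succeq_i\Pi^{ -1}(a_i)$, and (T2) there are no distinct $a_i,a_j$ with $a_j\succ_i\Pi^{ -1}(a_i)$ and $a_i\succ_j\Pi^{ -1}(a_j)$. An SF instance $J=(A,\succ,c)$ additionally assigns integer capacities $c_i$. A cyclic permutation of a nonempty set $A_r\subseteq A$ is a permutation $\Pi_r$ of $A_r$ consisting of a single cycle of length $|A_r|$ (length 1: a fixed point; length 2: a transposition). Two cyclic permutations are distinct if some element is mapped to different elements by them. A GSP of $J$ is a finite collection $\{\Pi_1,\dots,\Pi_k\}$ of cyclic permutations $\Pi_r$ of sets $A_r\subseteq A$, pairwise distinct except that fixed points may be repeated, such that: (F1) for every $r$ and every $a_j\in A_r$, $\Pi_r(a_j)\succeq_j\Pi_r^{ -1}(a_j)$; (F2) there are no distinct $a_i,a_j\in A$ with the transposition $(a_i\ a_j)$ not in the collection such that $a_j\succ_i\Pi_r^{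 -1}(a_i)$ and $a_i\succ_j\Pi_s^{ -1}(a_j)$ for some $\Pi_r,\Pi_s$ in the collection with $a_i\in A_r$, $a_j\in A_s$; (F3) for every $a_i\in A$, the number of indices $r$ with $a_i\in A_r$ equals $c_i$; (F4) for all distinct $a_i,a_j\in A$, $|\{s:\Pi_s(a_i)=a_j\}|+|\{s:\Pi_s(a_j)=a_i\}|\le 2$. -}

module Defs where

open import Data.Nat using (ℕ; zero; suc; _+_; _<_; _≤_)
open import Data.Nat.GeneralisedArithmetic using (iterate)
open import Data.Fin using (Fin; _≟_)
open import Data.Fin.Subset using (Subset; _∈_; _∉_; Nonempty; ∣_∣)
open import Data.Fin.Subset.Properties using (_∈?_)
open import Data.Fin.Permutation using (Permutation′; _⟨$⟩ʳ_; _⟨$⟩ˡ_)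
open import Data.Product using (Σ; ∃; _×_; _,_)
open import Data.Sum using (_⊎_)
open import Data.Empty using (⊥)
open import Relation.Nullary using (¬_; Dec; yes; no)
open import Relation.Binary.PropositionalEquality using (_≡_; _≢_)
open import Function.Bundles using (_⇔_)

-- Preferences: agent i ranks every agent by a natural
-- number (smaller = more preferred); ranks of agent i are pairwise
-- distinct (strict linear order) and i ranks itself last.

record Prefs (n : ℕ) : Set where
  field
    rank      : Fin n → Fin n → ℕ
    injective : ∀ i a b → rank i a ≡ rank i b → a ≡ b
    selfLast  : ∀ i a → a ≢ i → rank i a < rank i i

module _ {n : ℕ} (P : Prefs n) where
  open Prefs P

  Pref : Fin n → Fin n → Fin n → Set
  Pref i a b = rank i a < rank i b

  PrefEq : Fin n → Fin n → Fin n → Set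
  PrefEq i a b = Pref i a b ⊎ a ≡ b

module _ {n : ℕ} (P : Prefs n) (Π : Permutation′ n) where

  T1 : Set
  T1 = ∀ i → PrefEq P i (Π ⟨$⟩ʳ i) (Π ⟨$⟩ˡ i)

  T2 : Set
  T2 = ¬ (Σ (Fin n) λ i → Σ (Fin n) λ j → i ≢ j ×
          Pref P i j (Π ⟨$⟩ˡ i) × Pref P j i (Π ⟨$⟩ˡ j))

  IsStablePartition : Set
  IsStablePartition = T1 × T2

count : (k : ℕ) → {Q : Fin k → Set} → (∀ r → Dec (Q r)) → ℕ
count zero    d = 0
count (suc k) d with d Fin.zero
... | yes _ = suc (count k (λ r → d (Fin.suc r)))
... | no  _ = count k (λ r → d (Fin.suc r))

-- A cyclic permutation Π_r of a nonempty set A_r ⊆ A.  It is represented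
-- by its domain A_r together with a permutation of A that acts on A_r as
-- a single cycle of length |A_r| and is the identity outside A_r.

record Cycle (n : ℕ) : Set where
  field
    dom      : Subset n
    perm     : Permutation′ n
    nonempty : Nonempty dom
    idOut    : ∀ x → x ∉ dom → perm ⟨$⟩ʳ x ≡ x
    single   : ∀ x y → x ∈ dom → y ∈ dom →
               Σ ℕ λ m → iterate (perm ⟨$⟩ʳ_) x m ≡ y

open Cycle public

SameCycle : ∀ {n} → Cycle n → Cycle n → Set
SameCycle C D = (∀ x → (x ∈ dom C) ⇔ (x ∈ dom D)) ×
                (∀ x → x ∈ dom C → perm C ⟨$⟩ʳ x ≡ perm D ⟨$⟩ʳ x)

IsFixedPoint : ∀ {n} → Cycle n → Set
IsFixedPoint C = ∣ dom C ∣ ≡ 1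

IsTransposition : ∀ {n} → Fin n → Fin n → Cycle n → Set
IsTransposition i j C = (∀ x → (x ∈ dom C) ⇔ (x ≡ i ⊎ x ≡ j)) ×
                        perm C ⟨$⟩ʳ i ≡ j × perm C ⟨$⟩ʳ j ≡ i

-- A finite collection {Π_1, …, Π_k} (a multiset, indexed by Fin k).
Collection : ℕ → Set
Collection n = Σ ℕ λ k → (Fin k → Cycle n)

module _ {n : ℕ} (P : Prefs n) (c : Fin n → ℕ) (𝒞 : Collection n) where
  private
    k = Σ.proj₁ 𝒞
    C = Σ.proj₂ 𝒞

  -- pairwise distinct, except that fixed points may be repeated
  PairwiseDistinct : Set
  PairwiseDistinct = ∀ r s → r ≢ s → SameCycle (C r) (C s) → IsFixedPoint (C r)

  F1 : Set
  F1 = ∀ r j → j ∈ dom (C r) → PrefEq P j (perm (C r) ⟨$⟩ʳ j) (perm (C r) ⟨$⟩ˡ j)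

  F2 : Set
  F2 = ¬ (Σ (Fin n) λ i → Σ (Fin n) λ j → i ≢ j ×
          ¬ (Σ (Fin k) λ r → IsTransposition i j (C r)) ×
          Σ (Fin k) λ r → Σ (Fin k) λ s → i ∈ dom (C r) × j ∈ dom (C s) ×
          Pref P i j (perm (C r) ⟨$⟩ˡ i) × Pref P j i (perm (C s) ⟨$⟩ˡ j))

  F3 : Set
  F3 = ∀ i → count k (λ r → i ∈? dom (C r)) ≡ c i

  F4 : Set
  F4 = ∀ i j → i ≢ j →
       count k (λ s → perm (C s) ⟨$⟩ʳ i ≟ j) + count k (λ s → perm (C s) ⟨$⟩ʳ j ≟ i) ≤ 2

  IsGSP : Set
  IsGSP = PairwiseDistinct × F1 × F2 × F3 × F4

IsCycleDecomposition : ∀ {n} → Permutation′ n → Collection n → Set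
IsCycleDecomposition Π (k , C) =
  (∀ r x → x ∈ dom (C r) → perm (C r) ⟨$⟩ʳ x ≡ Π ⟨$⟩ʳ x) ×
  (∀ x → count k (λ r → x ∈? dom (C r)) ≡ 1)

module Submission where

open import Defs
open import Data.Nat using (ℕ; zero; suc; _≤_; _<_; z≤n; s≤s)
open import Data.Nat.Properties using (≤-trans; n≤1+n; +-mono-≤; <-irrefl)
open import Data.Fin using (Fin; _≟_)
open import Data.Fin.Subset using (_∈_)
open import Data.Fin.Subset.Properties using (_∈?_)
open import Data.Fin.Permutation using (Permutation′; _⟨$⟩ʳ_; _⟨$⟩ˡ_; inverseˡ; inverseʳ)
open import Data.Product using (Σ; _,_; proj₁; proj₂)
open import Data.Sum using (inj₂)
open import Data.Empty using (⊥-elim)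
open import Relation.Nullary using (¬_; Dec; yes; no)
open import Relation.Binary.PropositionalEquality
open import Function.Bundles using (_⇔_; Equivalence; mk⇔)

-- In a cycle decomposition every agent lies in exactly one cycle, on which the cycle acts
-- as Π and hence its inverse as Π⁻¹.  So T1 and F1 are the same condition, and F2 is T2
-- with the extra exception of pairs forming a transposition (i j) of the decomposition;
-- such a pair is never blocking, because then Π⁻¹(i) = j.  The remaining GSP conditions
-- hold for every cycle decomposition: distinct cycles have disjoint domains, so none is
-- repeated, every agent is covered once, and Π_s(i) = j ≠ i forces i into the single
-- cycle containing it.

count-witness : ∀ k {Q : Fin k → Set} (d : ∀ r → Dec (Q r)) → 0 < count k d → Σ (Fin k) Q
count-witness (suc k) d p with d Fin.zero
... | yes q = Fin.zero , q
... | no _ with count-witness k (λ r → d (Fin.suc r)) p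
...   | r , q = Fin.suc r , q

witness⇒1≤count : ∀ k {Q : Fin k → Set} (d : ∀ r → Dec (Q r)) r → Q r → 1 ≤ count k d
witness⇒1≤count (suc k) d r q with d Fin.zero
witness⇒1≤count (suc k) d r          q | yes _ = s≤s z≤n
witness⇒1≤count (suc k) d Fin.zero    q | no ¬q = ⊥-elim (¬q q)
witness⇒1≤count (suc k) d (Fin.suc r) q | no _  = witness⇒1≤count k (λ r → d (Fin.suc r)) r q

witnesses⇒2≤count : ∀ k {Q : Fin k → Set} (d : ∀ r → Dec (Q r)) r s →
                    r ≢ s → Q r → Q s → 2 ≤ count k d
witnesses⇒2≤count (suc k) d r s r≢s qr qs with d Fin.zero
witnesses⇒2≤count (suc k) d Fin.zero    Fin.zero    r≢s qr qs | _     = ⊥-elim (r≢s refl)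
witnesses⇒2≤count (suc k) d Fin.zero    (Fin.suc s) r≢s qr qs | yes _ = s≤s (witness⇒1≤count k _ s qs)
witnesses⇒2≤count (suc k) d (Fin.suc r) Fin.zero    r≢s qr qs | yes _ = s≤s (witness⇒1≤count k _ r qr)
witnesses⇒2≤count (suc k) d (Fin.suc r) (Fin.suc s) r≢s qr qs | yes _ =
  ≤-trans (witnesses⇒2≤count k _ r s (λ e → r≢s (cong Fin.suc e)) qr qs) (n≤1+n _)
witnesses⇒2≤count (suc k) d Fin.zero    s           r≢s qr qs | no ¬q = ⊥-elim (¬q qr)
witnesses⇒2≤count (suc k) d (Fin.suc r) Fin.zero    r≢s qr qs | no ¬q = ⊥-elim (¬q qs)
witnesses⇒2≤count (suc k) d (Fin.suc r) (Fin.suc s) r≢s qr qs | no _  =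
  witnesses⇒2≤count k _ r s (λ e → r≢s (cong Fin.suc e)) qr qs

count-mono : ∀ k {Q Q′ : Fin k → Set} (d : ∀ r → Dec (Q r)) (d′ : ∀ r → Dec (Q′ r)) →
             (∀ r → Q r → Q′ r) → count k d ≤ count k d′
count-mono zero    d d′ f = z≤n
count-mono (suc k) d d′ f with d Fin.zero | d′ Fin.zero
... | yes q | yes _   = s≤s (count-mono k _ _ (λ r → f (Fin.suc r)))
... | yes q | no ¬q′  = ⊥-elim (¬q′ (f Fin.zero q))
... | no _  | yes _   = ≤-trans (count-mono k _ _ (λ r → f (Fin.suc r))) (n≤1+n _)
... | no _  | no _    = count-mono k _ _ (λ r → f (Fin.suc r))

moved⇒∈dom : ∀ {n} (C : Cycle n) {x} → perm C ⟨$⟩ʳ x ≢ x → x ∈ dom C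
moved⇒∈dom C {x} moved with x ∈? dom C
... | yes x∈ = x∈
... | no  x∉ = ⊥-elim (moved (idOut C x x∉))

preimage-∈dom : ∀ {n} (C : Cycle n) {x} → x ∈ dom C → perm C ⟨$⟩ˡ x ∈ dom C
preimage-∈dom C {x} x∈ with perm C ⟨$⟩ˡ x ∈? dom C
... | yes y∈ = y∈
... | no  y∉ = subst (_∈ dom C) (sym (trans (sym (idOut C _ y∉)) (inverseʳ (perm C)))) x∈

agree⇒inverse-agree : ∀ {n} (C : Cycle n) (Π : Permutation′ n) →
                      (∀ x → x ∈ dom C → perm C ⟨$⟩ʳ x ≡ Π ⟨$⟩ʳ x) →
                      ∀ x → x ∈ dom C → perm C ⟨$⟩ˡ x ≡ Π ⟨$⟩ˡ x
agree⇒inverse-agree C Π agree x x∈ = begin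
  perm C ⟨$⟩ˡ x                         ≡⟨ inverseˡ Π ⟨
  Π ⟨$⟩ˡ (Π ⟨$⟩ʳ (perm C ⟨$⟩ˡ x))       ≡⟨ cong (Π ⟨$⟩ˡ_) (agree _ (preimage-∈dom C x∈)) ⟨
  Π ⟨$⟩ˡ (perm C ⟨$⟩ʳ (perm C ⟨$⟩ˡ x))  ≡⟨ cong (Π ⟨$⟩ˡ_) (inverseʳ (perm C)) ⟩
  Π ⟨$⟩ˡ x                              ∎
  where open ≡-Reasoning

module CycleDecomposition {n} (Π : Permutation′ n) {k} (C : Fin k → Cycle n)
                          (decomposition : IsCycleDecomposition Π (k , C)) where

  agree : ∀ r x → x ∈ dom (C r) → perm (C r) ⟨$⟩ʳ x ≡ Π ⟨$⟩ʳ x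
  agree = proj₁ decomposition

  covered-once : ∀ x → count k (λ r → x ∈? dom (C r)) ≡ 1
  covered-once = proj₂ decomposition

  inverse-agree : ∀ r x → x ∈ dom (C r) → perm (C r) ⟨$⟩ˡ x ≡ Π ⟨$⟩ˡ x
  inverse-agree r = agree⇒inverse-agree (C r) Π (agree r)

  cycleOf : ∀ x → Σ (Fin k) λ r → x ∈ dom (C r)
  cycleOf x = count-witness k _ (subst (0 <_) (sym (covered-once x)) (s≤s z≤n))

  ∈-unique : ∀ {x r s} → x ∈ dom (C r) → x ∈ dom (C s) → r ≡ s
  ∈-unique {x} {r} {s} x∈r x∈s with r ≟ s
  ... | yes r≡s = r≡s
  ... | no  r≢s with subst (2 ≤_) (covered-once x) (witnesses⇒2≤count k _ r s r≢s x∈r x∈s)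
  ...   | s≤s ()

  transposition⇒inverse : ∀ {i j t} → IsTransposition i j (C t) → Π ⟨$⟩ˡ i ≡ j
  transposition⇒inverse {i} {j} {t} (dom⇔ , _ , tj≡i) = begin
    Π ⟨$⟩ˡ i                   ≡⟨ cong (Π ⟨$⟩ˡ_) tj≡i ⟨
    Π ⟨$⟩ˡ (perm (C t) ⟨$⟩ʳ j) ≡⟨ cong (Π ⟨$⟩ˡ_) (agree t j (Equivalence.from (dom⇔ j) (inj₂ refl))) ⟩
    Π ⟨$⟩ˡ (Π ⟨$⟩ʳ j)          ≡⟨ inverseˡ Π ⟩
    j                          ∎
    where open ≡-Reasoning

  successor-count≤1 : ∀ i j → i ≢ j → count k (λ s → perm (C s) ⟨$⟩ʳ i ≟ j) ≤ 1
  successor-count≤1 i j i≢j = subst (count k (λ s → perm (C s) ⟨$⟩ʳ i ≟ j) ≤_) (covered-once i)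
    (count-mono k _ (λ r → i ∈? dom (C r)) λ s e →
      moved⇒∈dom (C s) λ fixed → i≢j (trans (sym fixed) e))

  module Conditions (P : Prefs n) (c : Fin n → ℕ) where

    pairwiseDistinct : PairwiseDistinct P c (k , C)
    pairwiseDistinct r s r≢s (dom⇔ , _) with nonempty (C r)
    ... | x , x∈ = ⊥-elim (r≢s (∈-unique x∈ (Equivalence.to (dom⇔ x) x∈)))

    f4 : F4 P c (k , C)
    f4 i j i≢j = +-mono-≤ (successor-count≤1 i j i≢j) (successor-count≤1 j i (≢-sym i≢j))

    T1⇒F1 : T1 P Π → F1 P c (k , C)
    T1⇒F1 t1 r j j∈ = subst₂ (PrefEq P j) (sym (agree r j j∈)) (sym (inverse-agree r j j∈)) (t1 j)

    F1⇒T1 : F1 P c (k , C) → T1 P Π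
    F1⇒T1 f1 i with cycleOf i
    ... | r , i∈ = subst₂ (PrefEq P i) (agree r i i∈) (inverse-agree r i i∈) (f1 r i i∈)

    T2⇒F2 : T2 P Π → F2 P c (k , C)
    T2⇒F2 t2 (i , j , i≢j , _ , r , s , i∈ , j∈ , j≻ᵢ , i≻ⱼ) =
      t2 (i , j , i≢j , subst (Pref P i j) (inverse-agree r i i∈) j≻ᵢ
                      , subst (Pref P j i) (inverse-agree s j j∈) i≻ⱼ)

    F2⇒T2 : F2 P c (k , C) → T2 P Π
    F2⇒T2 f2 (i , j , i≢j , j≻ᵢ , i≻ⱼ) with cycleOf i | cycleOf j
    ... | r , i∈ | s , j∈ =
      f2 (i , j , i≢j , notTransposition , r , s , i∈ , j∈
             , subst (Pref P i j) (sym (inverse-agree r i i∈)) j≻ᵢ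
             , subst (Pref P j i) (sym (inverse-agree s j j∈)) i≻ⱼ)
      where
      notTransposition : ¬ (Σ (Fin k) λ t → IsTransposition i j (C t))
      notTransposition (t , τ) = <-irrefl refl (subst (Pref P i j) (transposition⇒inverse τ) j≻ᵢ)

lemma3 : ∀ {n} (P : Prefs n) (Π : Permutation′ n) (𝒞 : Collection n) →
         IsCycleDecomposition Π 𝒞 →
         IsStablePartition P Π ⇔ IsGSP P (λ _ → 1) 𝒞
lemma3 P Π (k , C) decomposition = mk⇔ stable⇒GSP GSP⇒stable
  where
  open CycleDecomposition Π C decomposition
  open Conditions P (λ _ → 1)

  stable⇒GSP : IsStablePartition P Π → IsGSP P (λ _ → 1) (k , C)
  stable⇒GSP (t1 , t2) = pairwiseDistinct , T1⇒F1 t1 , T2⇒F2 t2 , covered-once , f4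

  GSP⇒stable : IsGSP P (λ _ → 1) (k , C) → IsStablePartition P Π
  GSP⇒stable (_ , f1 , f2 , _) = F1⇒T1 f1 , F2⇒T2 f2
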